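{- For each $n\ge1$, the number of permutations in $\operatorname{Sort}_n(\operatorname{SC}_{123})$ whose first entry is $n$ equals $M_{n-1}$.
   Context: $S_n$ is the set of permutations of $[n]$ in one-line notation. Two sequences of distinct integers have the same relative order if replacing the $i$th smallest entry of each by $i$ yields the same word; a permutation contains $\sigma$ classically (resp. consecutively) if some subsequence (resp. consecutive subsequence) has the same relative order as $\sigma$, and avoids it otherwise. $\operatorname{SC}_{123}:S_n\to S_n$ sends a permutation through a stack: at each step, if there is a next input entry and placing it on top of the stack would make the stack contents, read top to bottom, avoid $123$ consecutively, push it; otherwise pop the top entry to the end of the output; stop when the output has length $n$. $\operatorname{Sort}_n(\operatorname{SC}_{123})$ is the set of $\pi\in S_n$ with $\operatorname{SC}_{123}(\pi)$ avoiding $231$ classically. Motzkin numbers: $M_0=M_1=1$ and $M_n=M_{n-1}+\sum_{i=0}^{n-2}M_iM_{n-2-i}$ for $n\ge2$. -}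

module Defs where

open import Data.Nat using (ℕ; zero; suc; _+_; _*_; _∸_; _<ᵇ_; _≡ᵇ_)
open import Data.Bool using (Bool; true; false; not; _∧_; _∨_; if_then_else_)
open import Data.List using (List; []; _∷_; _++_; [_]; map; filter; length; zipWith; reverse; concatMap)
open import Data.Bool.ListAction using (any)
open import Data.Nat.ListAction using (sum)
open import Data.Product using (_×_; _,_)

-- ## Permutations of [n] = {1,…,n} in one-line notation, as lists of ℕ

insertAll : ℕ → List ℕ → List (List ℕ)
insertAll x []       = (x ∷ []) ∷ []
insertAll x (y ∷ ys) = (x ∷ y ∷ ys) ∷ map (y ∷_) (insertAll x ys)

S : ℕ → List (List ℕ)
S zero    = [] ∷ []
S (suc n) = concatMap (insertAll (suc n)) (S n)

countLess : ℕ → List ℕ → ℕ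
countLess x []       = 0
countLess x (y ∷ ys) = if y <ᵇ x then suc (countLess x ys) else countLess x ys

std : List ℕ → List ℕ
std w = map (λ x → suc (countLess x w)) w

eqList : List ℕ → List ℕ → Bool
eqList []       []       = true
eqList (x ∷ xs) (y ∷ ys) = (x ≡ᵇ y) ∧ eqList xs ys
eqList _        _        = false

-- same relative order (for sequences of distinct integers)
sameOrder : List ℕ → List ℕ → Bool
sameOrder u v = eqList (std u) (std v)

subseqs : ℕ → List ℕ → List (List ℕ)
subseqs zero    _        = [] ∷ []
subseqs (suc k) []       = []
subseqs (suc k) (x ∷ xs) = map (x ∷_) (subseqs k xs) ++ subseqs (suc k) xs

take' : ℕ → List ℕ → List ℕ
take' zero    _        = []
take' (suc k) []       = []
take' (suc k) (x ∷ xs) = x ∷ take' k xs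

factors : ℕ → List ℕ → List (List ℕ)
factors k []       = if k ≡ᵇ 0 then [] ∷ [] else []
factors k (x ∷ xs) =
  (if k ≤ᵇ' length (x ∷ xs) then take' k (x ∷ xs) ∷ [] else []) ++ factors k xs
  where
  _≤ᵇ'_ : ℕ → ℕ → Bool
  a ≤ᵇ' b = a <ᵇ suc b

containsC : List ℕ → List ℕ → Bool
containsC σ π = any (sameOrder σ) (subseqs (length σ) π)

avoidsC : List ℕ → List ℕ → Bool
avoidsC σ π = not (containsC σ π)

containsCons : List ℕ → List ℕ → Bool
containsCons σ π = any (sameOrder σ) (factors (length σ) π)

avoidsCons : List ℕ → List ℕ → Bool
avoidsCons σ π = not (containsCons σ π)

p123 : List ℕ
p123 = 1 ∷ 2 ∷ 3 ∷ []

p231 : List ℕ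
p231 = 2 ∷ 3 ∷ 1 ∷ []

-- ## The stack map SC_123
-- The stack is a list whose head is the top, so the list itself is the
-- stack contents read top to bottom.

-- one run with fuel; state = (input, stack, output)
run : ℕ → List ℕ → List ℕ → List ℕ → List ℕ
run zero     _        _        out = out
run (suc f)  []       []       out = out
run (suc f)  []       (t ∷ st) out = run f [] st (out ++ [ t ])
run (suc f)  (x ∷ xs) st       out =
  if avoidsCons p123 (x ∷ st)
  then run f xs (x ∷ st) out
  else popStep st
  where
  popStep : List ℕ → List ℕ
  popStep []       = run f xs (x ∷ []) out   -- unreachable: pushing on empty stack is always allowed
  popStep (t ∷ ts) = run f (x ∷ xs) ts (out ++ [ t ])

-- every entry is pushed once and popped once, so 2·length steps suffice
SC123 : List ℕ → List ℕ
SC123 π = run (2 * length π) π [] []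

sortable : List ℕ → Bool
sortable π = avoidsC p231 (SC123 π)

firstIs : ℕ → List ℕ → Bool
firstIs n []      = false
firstIs n (x ∷ _) = x ≡ᵇ n

countSortFirstN : ℕ → ℕ
countSortFirstN n = length (filter (λ π → Data.Bool.T? (firstIs n π ∧ sortable π)) (S n))
  where import Data.Bool

-- ## Motzkin numbers
-- motzRev k = [M_{k-1}, …, M_0]
motzNext : List ℕ → ℕ
motzNext []      = 1
motzNext (m ∷ t) = m + sum (zipWith _*_ t (reverse t))

motzRev : ℕ → List ℕ
motzRev zero    = []
motzRev (suc k) = motzNext (motzRev k) ∷ motzRev k

Motzkin : ℕ → ℕ
Motzkin n = motzNext (motzRev n)

-- If π = n σ, the entry n stays at the bottom of the stack, so SC₁₂₃(π) = SCmax(σ) n, where SCmax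
-- runs the stack on σ with one extra popping rule that accounts for the hidden n: an entry t alone
-- above n is popped by any smaller x.  Hence π is sortable iff SCmax(σ) avoids 231.  Write
-- σ = α k β with k = max σ.  If α = [] the condition reduces to the same condition on β.  Otherwise it
-- holds iff β lies entirely below α, β satisfies it, and α is admissible: α is pushed without a single
-- pop (any popped entry would form a 231 with k) and its reversal avoids 231.  Admissibility splits at
-- the maximum in the same way.  Counting through the insertion of the maximum into permutations of
-- [m], the numbers gₘ of such σ in Sₘ and aₘ₊₁ of admissible α in Sₘ₊₁ satisfy
-- gₘ₊₁ = gₘ + Σ_{i<m} aᵢ₊₁ gₘ₋₁₋ᵢ and aₘ₊₁ = [m = 0] + Σ_{i<m} aᵢ₊₁ aₘ₋₁₋ᵢ (where a₀ = 1),
-- whence both equal Mₘ by the Motzkin recurrence.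

{-# OPTIONS --safe #-}
module Submission where

open import Defs
open import Data.Bool using (Bool; true; false; not; _∧_; _∨_; if_then_else_; T)
open import Data.Bool.ListAction using (all; any; or)
open import Data.Bool.Properties
  using (∧-assoc; ∨-assoc; ∧-comm; ∧-distribˡ-∨; ∧-zeroʳ; ∧-identityʳ; ∨-zeroʳ; ∨-identityʳ;
         ∧-conicalˡ; ∧-conicalʳ; ∨-conicalˡ; ∨-conicalʳ; not-injective;
         ∨-isCommutativeMonoid; ∧-isCommutativeMonoid)
open import Data.Bool.Solver using (module ∨-∧-Solver)
open import Data.Empty using (⊥-elim)
open import Data.List
  using (List; []; _∷_; _++_; [_]; length; map; foldr; filter; concatMap; take; drop; null;
         reverse; _ʳ++_; zipWith; applyUpTo; applyDownFrom)
open import Data.List.Properties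
  using (++-assoc; ++-identityʳ; map-∘; map-cong; map-++; length-map; take-map; drop-map; length-take;
         take++drop≡id; ++-ʳ++; ʳ++-defn; reverse-map; reverse-applyDownFrom)
open import Data.List.Relation.Binary.Permutation.Propositional
  using (_↭_; ↭-refl; ↭-reflexive; ↭-prep; ↭-swap; ↭-trans; ↭⇒↭ₛ; module PermutationReasoning)
open import Data.List.Relation.Binary.Permutation.Propositional.Properties
  using (map⁺; ++⁺ˡ; shift; shifts; ↭-reverse; ↭-length)
open import Data.List.Relation.Binary.Permutation.Setoid.Properties using (foldr-commMonoid)
open import Data.List.Relation.Unary.All as All using (All; []; _∷_)
open import Data.List.Relation.Unary.All.Properties using (concat⁺) renaming (map⁺ to All-map⁺)
open import Data.Nat
open import Data.Nat.Induction using (<-rec)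
open import Data.Nat.ListAction using (sum)
open import Data.Nat.Properties
open import Algebra.Properties.CommutativeSemigroup +-commutativeSemigroup using (interchange)
open import Data.Product using (_×_; _,_; proj₁; proj₂; ∃₂)
open import Function using (_∘_)
open import Relation.Binary using (tri<; tri≈; tri>)
open import Relation.Binary.PropositionalEquality hiding ([_])
open import Relation.Nullary.Decidable.Core using (T?)

open ∨-∧-Solver using (solve; _:+_; _:*_; _:=_)

<ᵇ-sound : ∀ a b → (a <ᵇ b) ≡ true → a < b
<ᵇ-sound a b e = <ᵇ⇒< a b (subst T (sym e) _)

<ᵇ-true : ∀ {a b} → a < b → (a <ᵇ b) ≡ true
<ᵇ-true {a} {b} a<b with a <ᵇ b | <⇒<ᵇ a<b
... | true | _ = refl

<ᵇ-false : ∀ {a b} → b ≤ a → (a <ᵇ b) ≡ false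
<ᵇ-false {a} {b} b≤a with a <ᵇ b in e
... | false = refl
... | true = ⊥-elim (≤⇒≯ b≤a (<ᵇ-sound a b e))

<ᵇ-false⇒≥ : ∀ a b → (a <ᵇ b) ≡ false → b ≤ a
<ᵇ-false⇒≥ a b e = ≮⇒≥ (λ a<b → subst T e (<⇒<ᵇ a<b))

<ᵇ-irrefl : ∀ a → (a <ᵇ a) ≡ false
<ᵇ-irrefl a = <ᵇ-false {a} ≤-refl

<ᵇ-asym : ∀ a b → (a <ᵇ b) ≡ true → (b <ᵇ a) ≡ false
<ᵇ-asym a b e = <ᵇ-false (<⇒≤ (<ᵇ-sound a b e))

<ᵇ-trans : ∀ a b c → (a <ᵇ b) ≡ true → (b <ᵇ c) ≡ true → (a <ᵇ c) ≡ true
<ᵇ-trans a b c e f = <ᵇ-true (<-trans (<ᵇ-sound a b e) (<ᵇ-sound b c f))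

<ᵇ-shift : ∀ c a b → ((c + a) <ᵇ (c + b)) ≡ (a <ᵇ b)
<ᵇ-shift zero    a b = refl
<ᵇ-shift (suc c) a b = <ᵇ-shift c a b

≡ᵇ-refl : ∀ n → (n ≡ᵇ n) ≡ true
≡ᵇ-refl zero    = refl
≡ᵇ-refl (suc n) = ≡ᵇ-refl n

<ᵇ⇒≢ᵇ : ∀ y k → (y <ᵇ k) ≡ true → (y ≡ᵇ k) ≡ false
<ᵇ⇒≢ᵇ y k y<k with y ≡ᵇ k in e
... | false = refl
... | true  = ⊥-elim (<-irrefl (≡ᵇ⇒≡ y k (subst T (sym e) _)) (<ᵇ-sound y k y<k))

not-∨ : ∀ a b → not (a ∨ b) ≡ not a ∧ not b
not-∨ false b = refl
not-∨ true  b = refl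

all-++ : ∀ {A : Set} (p : A → Bool) xs ys → all p (xs ++ ys) ≡ all p xs ∧ all p ys
all-++ p []       ys = refl
all-++ p (x ∷ xs) ys = trans (cong (p x ∧_) (all-++ p xs ys)) (sym (∧-assoc (p x) _ _))

any-++ : ∀ {A : Set} (p : A → Bool) xs ys → any p (xs ++ ys) ≡ any p xs ∨ any p ys
any-++ p []       ys = refl
any-++ p (x ∷ xs) ys = trans (cong (p x ∨_) (any-++ p xs ys)) (sym (∨-assoc (p x) _ _))

any-map : ∀ {A B : Set} (p : B → Bool) (f : A → B) xs → any p (map f xs) ≡ any (p ∘ f) xs
any-map p f xs = cong or (sym (map-∘ xs))

any-cong : ∀ {A : Set} {p q : A → Bool} → (∀ x → p x ≡ q x) → ∀ xs → any p xs ≡ any q xs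
any-cong p≗q xs = cong or (map-cong p≗q xs)

all-mono : ∀ (p q : ℕ → Bool) → (∀ v → p v ≡ true → q v ≡ true) →
           ∀ w → all p w ≡ true → all q w ≡ true
all-mono p q p⇒q []      _ = refl
all-mono p q p⇒q (x ∷ w) h rewrite p⇒q x (∧-conicalˡ _ _ h) = all-mono p q p⇒q w (∧-conicalʳ _ _ h)

all-take-drop : ∀ (p : ℕ → Bool) j σ → all p σ ≡ all p (take j σ) ∧ all p (drop j σ)
all-take-drop p j σ = trans (cong (all p) (sym (take++drop≡id j σ))) (all-++ p (take j σ) (drop j σ))

any-↭ : ∀ {A : Set} (p : A → Bool) {xs ys} → xs ↭ ys → any p xs ≡ any p ys
any-↭ p q = foldr-commMonoid (setoid Bool) ∨-isCommutativeMonoid (↭⇒↭ₛ (map⁺ p q))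

all-↭ : ∀ {A : Set} (p : A → Bool) {xs ys} → xs ↭ ys → all p xs ≡ all p ys
all-↭ p q = foldr-commMonoid (setoid Bool) ∧-isCommutativeMonoid (↭⇒↭ₛ (map⁺ p q))

-- Patterns of length three

sameOrder-123-231 : ∀ a b c →
  (sameOrder p123 (a ∷ b ∷ c ∷ []) ≡ (a <ᵇ b) ∧ (b <ᵇ c)) ×
  (sameOrder p231 (a ∷ b ∷ c ∷ []) ≡ (c <ᵇ a) ∧ (a <ᵇ b))
sameOrder-123-231 a b c with <-cmp a b | <-cmp b c | <-cmp a c
... | tri< a<b _ _ | tri< b<c _ _ | _
  rewrite <ᵇ-true a<b | <ᵇ-false (<⇒≤ a<b) | <ᵇ-true b<c | <ᵇ-false (<⇒≤ b<c)
        | <ᵇ-true (<-trans a<b b<c) | <ᵇ-false (<⇒≤ (<-trans a<b b<c))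
        | <ᵇ-irrefl a | <ᵇ-irrefl b | <ᵇ-irrefl c = refl , refl
... | tri< a<b _ _ | tri≈ _ refl _ | _
  rewrite <ᵇ-true a<b | <ᵇ-false (<⇒≤ a<b) | <ᵇ-irrefl a | <ᵇ-irrefl b = refl , refl
... | tri< a<b _ _ | tri> _ _ c<b | tri< a<c _ _
  rewrite <ᵇ-true a<b | <ᵇ-false (<⇒≤ a<b) | <ᵇ-true c<b | <ᵇ-false (<⇒≤ c<b)
        | <ᵇ-true a<c | <ᵇ-false (<⇒≤ a<c)
        | <ᵇ-irrefl a | <ᵇ-irrefl b = refl , refl
... | tri< a<b _ _ | tri> _ _ c<b | tri≈ _ refl _
  rewrite <ᵇ-true a<b | <ᵇ-false (<⇒≤ a<b) | <ᵇ-irrefl a | <ᵇ-irrefl b = refl , refl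
... | tri< a<b _ _ | tri> _ _ c<b | tri> _ _ c<a
  rewrite <ᵇ-true a<b | <ᵇ-false (<⇒≤ a<b) | <ᵇ-true c<b | <ᵇ-false (<⇒≤ c<b)
        | <ᵇ-true c<a | <ᵇ-false (<⇒≤ c<a)
        | <ᵇ-irrefl a | <ᵇ-irrefl b | <ᵇ-irrefl c = refl , refl
... | tri≈ _ refl _ | tri< b<c _ _ | _
  rewrite <ᵇ-true b<c | <ᵇ-false (<⇒≤ b<c) | <ᵇ-irrefl b = refl , refl
... | tri≈ _ refl _ | tri≈ _ refl _ | _
  rewrite <ᵇ-irrefl c = refl , refl
... | tri≈ _ refl _ | tri> _ _ c<b | _
  rewrite <ᵇ-true c<b | <ᵇ-false (<⇒≤ c<b) | <ᵇ-irrefl b = refl , refl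
... | tri> _ _ b<a | tri< b<c _ _ | tri< a<c _ _
  rewrite <ᵇ-true b<a | <ᵇ-false (<⇒≤ b<a) | <ᵇ-true b<c | <ᵇ-false (<⇒≤ b<c)
        | <ᵇ-true a<c | <ᵇ-false (<⇒≤ a<c)
        | <ᵇ-irrefl a | <ᵇ-irrefl b = refl , refl
... | tri> _ _ b<a | tri< b<c _ _ | tri≈ _ refl _
  rewrite <ᵇ-true b<a | <ᵇ-false (<⇒≤ b<a) | <ᵇ-irrefl a | <ᵇ-irrefl b = refl , refl
... | tri> _ _ b<a | tri< b<c _ _ | tri> _ _ c<a
  rewrite <ᵇ-true b<a | <ᵇ-false (<⇒≤ b<a) | <ᵇ-true b<c | <ᵇ-false (<⇒≤ b<c)
        | <ᵇ-true c<a | <ᵇ-false (<⇒≤ c<a)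
        | <ᵇ-irrefl a = refl , refl
... | tri> _ _ b<a | tri≈ _ refl _ | _
  rewrite <ᵇ-true b<a | <ᵇ-false (<⇒≤ b<a) | <ᵇ-irrefl a = refl , refl
... | tri> _ _ b<a | tri> _ _ c<b | _
  rewrite <ᵇ-true b<a | <ᵇ-false (<⇒≤ b<a) | <ᵇ-true c<b | <ᵇ-false (<⇒≤ c<b)
        | <ᵇ-true (<-trans c<b b<a) | <ᵇ-false (<⇒≤ (<-trans c<b b<a))
        | <ᵇ-irrefl a = refl , refl

sameOrder-123 : ∀ a b c → sameOrder p123 (a ∷ b ∷ c ∷ []) ≡ (a <ᵇ b) ∧ (b <ᵇ c)
sameOrder-123 a b c = proj₁ (sameOrder-123-231 a b c)

sameOrder-231 : ∀ a b c → sameOrder p231 (a ∷ b ∷ c ∷ []) ≡ (c <ᵇ a) ∧ (a <ᵇ b)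
sameOrder-231 a b c = proj₂ (sameOrder-123-231 a b c)

someBelow : ℕ → List ℕ → Bool
someBelow x = any (_<ᵇ x)

heads231 : ℕ → List ℕ → Bool
heads231 x []      = false
heads231 x (y ∷ w) = ((x <ᵇ y) ∧ someBelow x w) ∨ heads231 x w

has231 : List ℕ → Bool
has231 []      = false
has231 (x ∷ w) = heads231 x w ∨ has231 w

any231-∷∷ : ∀ x y w → any (λ s → sameOrder p231 (x ∷ y ∷ s)) (subseqs 1 w) ≡ (x <ᵇ y) ∧ someBelow x w
any231-∷∷ x y []      = sym (∧-zeroʳ (x <ᵇ y))
any231-∷∷ x y (z ∷ w) rewrite sameOrder-231 x y z | any231-∷∷ x y w =
  trans (cong (_∨ _) (∧-comm (z <ᵇ x) (x <ᵇ y))) (sym (∧-distribˡ-∨ (x <ᵇ y) (z <ᵇ x) _))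

any231-∷ : ∀ x w → any (λ s → sameOrder p231 (x ∷ s)) (subseqs 2 w) ≡ heads231 x w
any231-∷ x []      = refl
any231-∷ x (y ∷ w)
  rewrite any-++ (λ s → sameOrder p231 (x ∷ s)) (map (y ∷_) (subseqs 1 w)) (subseqs 2 w)
        | any-map (λ s → sameOrder p231 (x ∷ s)) (y ∷_) (subseqs 1 w)
        | any231-∷∷ x y w | any231-∷ x w = refl

containsC231≡has231 : ∀ w → containsC p231 w ≡ has231 w
containsC231≡has231 []      = refl
containsC231≡has231 (x ∷ w)
  rewrite any-++ (sameOrder p231) (map (x ∷_) (subseqs 2 w)) (subseqs 3 w)
        | any-map (sameOrder p231) (x ∷_) (subseqs 2 w)
        | any231-∷ x w | containsC231≡has231 w = refl

heads231⇒someBelow : ∀ x w → heads231 x w ≡ true → someBelow x w ≡ true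
heads231⇒someBelow x (y ∷ w) h with (x <ᵇ y) ∧ someBelow x w in e
... | true  = trans (cong ((y <ᵇ x) ∨_) (∧-conicalʳ _ _ e)) (∨-zeroʳ (y <ᵇ x))
... | false = trans (cong ((y <ᵇ x) ∨_) (heads231⇒someBelow x w h)) (∨-zeroʳ (y <ᵇ x))

heads231-max : ∀ k w → all (_<ᵇ k) w ≡ true → heads231 k w ≡ false
heads231-max k []      _ = refl
heads231-max k (y ∷ w) h rewrite <ᵇ-asym y k (∧-conicalˡ _ _ h) = heads231-max k w (∧-conicalʳ _ _ h)

someBelow-skip : ∀ x k L R → (x <ᵇ k) ≡ true → someBelow x (L ++ k ∷ R) ≡ someBelow x L ∨ someBelow x R
someBelow-skip x k L R x<k =
  trans (any-++ (_<ᵇ x) L (k ∷ R)) (cong (λ b → someBelow x L ∨ (b ∨ someBelow x R)) (<ᵇ-asym x k x<k))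

heads231-split : ∀ x k L R → (x <ᵇ k) ≡ true →
  heads231 x (L ++ k ∷ R) ≡ heads231 x L ∨ someBelow x R
heads231-split x k [] R x<k rewrite x<k with heads231 x R in e
... | true  = trans (∨-zeroʳ _) (sym (heads231⇒someBelow x R e))
... | false = ∨-identityʳ _
heads231-split x k (y ∷ L) R x<k
  rewrite heads231-split x k L R x<k | someBelow-skip x k L R x<k =
  absorb (x <ᵇ y) (someBelow x L) (someBelow x R) (heads231 x L)
  where
  absorb : ∀ a b c d → (a ∧ (b ∨ c)) ∨ (d ∨ c) ≡ ((a ∧ b) ∨ d) ∨ c
  absorb true  true  c d = refl
  absorb true  false true  d = sym (∨-zeroʳ d)
  absorb true  false false d = refl
  absorb false b     c d = refl

has231-above : ∀ k v u L → (v <ᵇ k) ≡ true → someBelow v L ≡ true → has231 (v ∷ u ++ k ∷ L) ≡ true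
has231-above k v u L v<k h rewrite heads231-split v k u L v<k | h | ∨-zeroʳ (heads231 v u) = refl

exceeds : List ℕ → List ℕ → Bool
exceeds L R = any (λ x → someBelow x R) L

exceeds-[] : ∀ v → exceeds v [] ≡ false
exceeds-[] []      = refl
exceeds-[] (_ ∷ v) = exceeds-[] v

exceeds-↭ : ∀ {L L′ R R′} → L ↭ L′ → R ↭ R′ → exceeds L R ≡ exceeds L′ R′
exceeds-↭ {L} {L′} {R} {R′} L↭L′ R↭R′ =
  trans (any-↭ (λ x → someBelow x R) L↭L′) (any-cong (λ x → any-↭ (_<ᵇ x) R↭R′) L′)

has231-split : ∀ k L R → all (_<ᵇ k) L ≡ true → all (_<ᵇ k) R ≡ true →
  has231 (L ++ k ∷ R) ≡ has231 L ∨ (has231 R ∨ exceeds L R)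
has231-split k []      R _  hR rewrite heads231-max k R hR = sym (∨-identityʳ (has231 R))
has231-split k (x ∷ L) R hL hR
  rewrite heads231-split x k L R (∧-conicalˡ _ _ hL) | has231-split k L R (∧-conicalʳ _ _ hL) hR =
  solve 5 (λ h s hL hR e → (h :+ s) :+ (hL :+ (hR :+ e)) := (h :+ hL) :+ (hR :+ (s :+ e))) refl
    (heads231 x L) (someBelow x R) (has231 L) (has231 R) (exceeds L R)

-- Stacks governed by a popping rule

Rule : Set
Rule = ℕ → List ℕ → Bool

popped : Rule → ℕ → List ℕ → List ℕ
popped r x []      = []
popped r x (t ∷ s) = if r x (t ∷ s) then t ∷ popped r x s else []

kept : Rule → ℕ → List ℕ → List ℕ
kept r x []      = []
kept r x (t ∷ s) = if r x (t ∷ s) then kept r x s else t ∷ s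

stackSort : Rule → List ℕ → List ℕ → List ℕ
stackSort r []       st = st
stackSort r (x ∷ xs) st = popped r x st ++ stackSort r xs (x ∷ kept r x st)

emitted : Rule → List ℕ → List ℕ → List ℕ
emitted r []       st = []
emitted r (x ∷ xs) st = popped r x st ++ emitted r xs (x ∷ kept r x st)

leftover : Rule → List ℕ → List ℕ → List ℕ
leftover r []       st = st
leftover r (x ∷ xs) st = leftover r xs (x ∷ kept r x st)

noPops : Rule → List ℕ → List ℕ → Bool
noPops r st []       = true
noPops r st (x ∷ xs) = not (r x st) ∧ noPops r (x ∷ st) xs

popped++kept : ∀ r x st → popped r x st ++ kept r x st ≡ st
popped++kept r x []      = refl
popped++kept r x (t ∷ s) with r x (t ∷ s)
... | true  = cong (t ∷_) (popped++kept r x s)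
... | false = refl

no-pop : ∀ r x st → r x st ≡ false → popped r x st ≡ [] × kept r x st ≡ st
no-pop r x []      _ = refl , refl
no-pop r x (t ∷ s) e rewrite e = refl , refl

all-kept : ∀ r x (p : ℕ → Bool) st → all p st ≡ true → all p (kept r x st) ≡ true
all-kept r x p st h = ∧-conicalʳ _ _
  (trans (sym (all-++ p (popped r x st) _)) (trans (cong (all p) (popped++kept r x st)) h))

stackSort-++ : ∀ r α γ st →
  stackSort r (α ++ γ) st ≡ emitted r α st ++ stackSort r γ (leftover r α st)
stackSort-++ r []      γ st = refl
stackSort-++ r (x ∷ α) γ st =
  trans (cong (popped r x st ++_) (stackSort-++ r α γ (x ∷ kept r x st)))
        (sym (++-assoc (popped r x st) _ _))

stackSort↭ : ∀ r inp st → stackSort r inp st ↭ inp ++ st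
stackSort↭ r []       st = ↭-refl
stackSort↭ r (x ∷ xs) st = begin
  popped r x st ++ stackSort r xs (x ∷ kept r x st) ↭⟨ ++⁺ˡ (popped r x st) (stackSort↭ r xs _) ⟩
  popped r x st ++ xs ++ x ∷ kept r x st            ↭⟨ ++⁺ˡ (popped r x st) (shift x xs _) ⟩
  popped r x st ++ x ∷ xs ++ kept r x st            ↭⟨ shifts (popped r x st) (x ∷ xs) ⟩
  x ∷ xs ++ popped r x st ++ kept r x st            ≡⟨ cong (λ s → x ∷ xs ++ s) (popped++kept r x st) ⟩
  x ∷ xs ++ st                                      ∎
  where open PermutationReasoning

stackSort≡emitted++leftover : ∀ r inp st → stackSort r inp st ≡ emitted r inp st ++ leftover r inp st
stackSort≡emitted++leftover r []       st = refl
stackSort≡emitted++leftover r (x ∷ xs) st =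
  trans (cong (popped r x st ++_) (stackSort≡emitted++leftover r xs (x ∷ kept r x st)))
        (sym (++-assoc (popped r x st) _ _))

emitted++leftover↭ : ∀ r inp st → emitted r inp st ++ leftover r inp st ↭ inp ++ st
emitted++leftover↭ r inp st = subst (_↭ inp ++ st) (stackSort≡emitted++leftover r inp st) (stackSort↭ r inp st)

all-emitted-leftover : ∀ r (p : ℕ → Bool) inp st →
  all p (emitted r inp st) ∧ all p (leftover r inp st) ≡ all p inp ∧ all p st
all-emitted-leftover r p inp st =
  trans (sym (all-++ p (emitted r inp st) _)) (trans (all-↭ p (emitted++leftover↭ r inp st)) (all-++ p inp st))

leftover-nonempty : ∀ r xs y s → ∃₂ λ t S → leftover r xs (y ∷ s) ≡ t ∷ S
leftover-nonempty r []       y s = y , s , refl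
leftover-nonempty r (x ∷ xs) y s = leftover-nonempty r xs x (kept r x (y ∷ s))

ʳ++-nonempty : ∀ {A : Set} (xs : List A) y s → ∃₂ λ t S → xs ʳ++ (y ∷ s) ≡ t ∷ S
ʳ++-nonempty []       y s = y , s , refl
ʳ++-nonempty (x ∷ xs) y s = ʳ++-nonempty xs x (y ∷ s)

noPops⇒ : ∀ r α st → noPops r st α ≡ true → emitted r α st ≡ [] × leftover r α st ≡ α ʳ++ st
noPops⇒ r []      st _ = refl , refl
noPops⇒ r (x ∷ α) st h with no-pop r x st (not-injective (∧-conicalˡ _ _ h))
... | e₁ , e₂ rewrite e₁ | e₂ = noPops⇒ r α (x ∷ st) (∧-conicalʳ _ _ h)

pops⇒ : ∀ r → (∀ x → r x [] ≡ false) →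
  ∀ α st → noPops r st α ≡ false → ∃₂ λ v o → emitted r α st ≡ v ∷ o
pops⇒ r r-[] (x ∷ α) st h with r x st in e
pops⇒ r r-[] (x ∷ α) []      h | true with () ← trans (sym e) (r-[] x)
pops⇒ r r-[] (x ∷ α) (t ∷ s) h | true rewrite e = t , _ , refl
pops⇒ r r-[] (x ∷ α) st      h | false with no-pop r x st e
... | e₁ , e₂ rewrite e₁ | e₂ = pops⇒ r r-[] α (x ∷ st) h

noPops-++ : ∀ r st u v → noPops r st (u ++ v) ≡ noPops r st u ∧ noPops r (u ʳ++ st) v
noPops-++ r st []      v = refl
noPops-++ r st (x ∷ u) v =
  trans (cong (not (r x st) ∧_) (noPops-++ r (x ∷ st) u v)) (sym (∧-assoc (not (r x st)) _ _))

module _ (r r′ : Rule) (Z : List ℕ) (p : ℕ → Bool)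
         (r-onFrame : ∀ x st → all p st ≡ true → r x (st ++ Z) ≡ r′ x st)
         (r′-[] : ∀ x → r′ x [] ≡ false) where

  popped-kept-onFrame : ∀ x st → all p st ≡ true →
    popped r x (st ++ Z) ≡ popped r′ x st × kept r x (st ++ Z) ≡ kept r′ x st ++ Z
  popped-kept-onFrame x []      _ = no-pop r x Z (trans (r-onFrame x [] refl) (r′-[] x))
  popped-kept-onFrame x (t ∷ s) h rewrite r-onFrame x (t ∷ s) h with r′ x (t ∷ s)
  ... | true  = cong (t ∷_) (proj₁ IH) , proj₂ IH
    where IH = popped-kept-onFrame x s (∧-conicalʳ _ _ h)
  ... | false = refl , refl

  stackSort-onFrame : ∀ σ st → all p σ ≡ true → all p st ≡ true →
    stackSort r σ (st ++ Z) ≡ stackSort r′ σ st ++ Z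
  stackSort-onFrame []      st _ _ = refl
  stackSort-onFrame (x ∷ σ) st hσ hst
    rewrite proj₁ (popped-kept-onFrame x st hst) | proj₂ (popped-kept-onFrame x st hst) =
    trans (cong (popped r′ x st ++_)
                (stackSort-onFrame σ (x ∷ kept r′ x st) (∧-conicalʳ _ _ hσ)
                   (trans (cong (_∧ all p (kept r′ x st)) (∧-conicalˡ _ _ hσ)) (all-kept r′ x p st hst))))
          (sym (++-assoc (popped r′ x st) _ Z))

  noPops-onFrame : ∀ σ st → all p σ ≡ true → all p st ≡ true → noPops r (st ++ Z) σ ≡ noPops r′ st σ
  noPops-onFrame []      st _  _   = refl
  noPops-onFrame (x ∷ σ) st hσ hst
    rewrite r-onFrame x st hst
          | noPops-onFrame σ (x ∷ st) (∧-conicalʳ _ _ hσ)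
              (trans (cong (_∧ all p st) (∧-conicalˡ _ _ hσ)) hst) = refl

-- The stack map SC₁₂₃

makes123 : Rule
makes123 x []          = false
makes123 x (t ∷ [])    = false
makes123 x (t ∷ u ∷ _) = (x <ᵇ t) ∧ (t <ᵇ u)

-- makes123 for a stack with an entry larger than all others hidden below its bottom
makes123OverMax : Rule
makes123OverMax x []          = false
makes123OverMax x (t ∷ [])    = x <ᵇ t
makes123OverMax x (t ∷ u ∷ _) = (x <ᵇ t) ∧ (t <ᵇ u)

containsCons123-∷ : ∀ x st → containsCons p123 (x ∷ st) ≡ makes123 x st ∨ containsCons p123 st
containsCons123-∷ x []          = refl
containsCons123-∷ x (t ∷ [])    = refl
containsCons123-∷ x (t ∷ u ∷ s) = cong (_∨ containsCons p123 (t ∷ u ∷ s)) (sameOrder-123 x t u)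

private
  fuel-push : ∀ a s f → suc a + suc a + s ≤ suc f → a + a + suc s ≤ f
  fuel-push a s f (s≤s le) = subst (_≤ f) (trans (cong (_+ s) (+-suc a a)) (sym (+-suc (a + a) s))) le

  fuel-pop : ∀ b s f → b + suc (suc s) ≤ suc f → b + suc s ≤ f
  fuel-pop b s f le rewrite +-suc b (suc s) with le
  ... | s≤s le′ = le′

-- each entry is pushed once and popped once, hence the fuel bound
run≡stackSort : ∀ f inp st out → containsCons p123 st ≡ false →
  length inp + length inp + length st ≤ f →
  run f inp st out ≡ out ++ stackSort makes123 inp st
run≡stackSort zero    []       []      out _ _ = sym (++-identityʳ out)
run≡stackSort (suc f) []       []      out _ _ = sym (++-identityʳ out)
run≡stackSort (suc f) []       (t ∷ st) out avoid (s≤s le) =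
  trans (run≡stackSort f [] st (out ++ [ t ]) (∨-conicalʳ _ _ (trans (sym (containsCons123-∷ t st)) avoid)) le)
        (++-assoc out [ t ] st)
run≡stackSort (suc f) (x ∷ xs) []       out _ le =
  run≡stackSort f xs [ x ] out refl (fuel-push (length xs) 0 f le)
run≡stackSort (suc f) (x ∷ xs) (t ∷ []) out _ le =
  run≡stackSort f xs (x ∷ t ∷ []) out refl (fuel-push (length xs) 1 f le)
run≡stackSort (suc f) (x ∷ xs) (t ∷ u ∷ s) out avoid le
  rewrite sameOrder-123 x t u | avoid with (x <ᵇ t) ∧ (t <ᵇ u) in e
... | false = run≡stackSort f xs (x ∷ t ∷ u ∷ s) out
                (trans (containsCons123-∷ x (t ∷ u ∷ s)) (cong₂ _∨_ e avoid))
                (fuel-push (length xs) (suc (suc (length s))) f le)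
... | true  = trans (run≡stackSort f (x ∷ xs) (u ∷ s) (out ++ [ t ])
                      (∨-conicalʳ _ _ (trans (sym (containsCons123-∷ t (u ∷ s))) avoid))
                      (fuel-pop (suc (length xs) + suc (length xs)) (length s) f le))
                    (++-assoc out [ t ] _)

SCmax : List ℕ → List ℕ
SCmax σ = stackSort makes123OverMax σ []

SCmax↭ : ∀ σ → SCmax σ ↭ σ
SCmax↭ σ = subst (SCmax σ ↭_) (++-identityʳ σ) (stackSort↭ makes123OverMax σ [])

all-SCmax : ∀ p σ → all p (SCmax σ) ≡ all p σ
all-SCmax p σ = all-↭ p (SCmax↭ σ)

SC123-max∷ : ∀ n σ → all (_<ᵇ n) σ ≡ true → SC123 (n ∷ σ) ≡ SCmax σ ++ [ n ]
SC123-max∷ n σ h = trans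
  (run≡stackSort (2 * length (n ∷ σ)) (n ∷ σ) [] [] refl (≤-reflexive (fuel (length (n ∷ σ)))))
  (stackSort-onFrame makes123 makes123OverMax [ n ] (_<ᵇ n) onFrame (λ _ → refl) σ [] h refl)
  where
  fuel : ∀ L → L + L + 0 ≡ 2 * L
  fuel L = trans (+-identityʳ (L + L)) (cong (L +_) (sym (+-identityʳ L)))
  onFrame : ∀ x st → all (_<ᵇ n) st ≡ true → makes123 x (st ++ [ n ]) ≡ makes123OverMax x st
  onFrame x []          _ = refl
  onFrame x (t ∷ [])    h rewrite ∧-conicalˡ (t <ᵇ n) true h = ∧-identityʳ (x <ᵇ t)
  onFrame x (t ∷ u ∷ _) _ = refl

sortableAfterMax : List ℕ → Bool
sortableAfterMax σ = not (has231 (SCmax σ))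

sortable-max∷ : ∀ k σ → all (_<ᵇ k) σ ≡ true → sortable (k ∷ σ) ≡ sortableAfterMax σ
sortable-max∷ k σ h = cong not (begin
  containsC p231 (SC123 (k ∷ σ))
    ≡⟨ cong (containsC p231) (SC123-max∷ k σ h) ⟩
  containsC p231 (SCmax σ ++ [ k ])
    ≡⟨ containsC231≡has231 (SCmax σ ++ [ k ]) ⟩
  has231 (SCmax σ ++ [ k ])
    ≡⟨ has231-split k (SCmax σ) [] (trans (all-SCmax (_<ᵇ k) σ) h) refl ⟩
  has231 (SCmax σ) ∨ (false ∨ exceeds (SCmax σ) [])
    ≡⟨ cong (has231 (SCmax σ) ∨_) (exceeds-[] (SCmax σ)) ⟩
  has231 (SCmax σ) ∨ false
    ≡⟨ ∨-identityʳ _ ⟩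
  has231 (SCmax σ) ∎)
  where open ≡-Reasoning

-- Splitting at the maximum

makes123OverMax⇒< : ∀ x t s → makes123OverMax x (t ∷ s) ≡ true → (x <ᵇ t) ≡ true
makes123OverMax⇒< x t []      e = e
makes123OverMax⇒< x t (u ∷ s) e = ∧-conicalˡ _ _ e

makes123OverMax-larger : ∀ x t S → (t <ᵇ x) ≡ true → makes123OverMax x (t ∷ S) ≡ false
makes123OverMax-larger x t []      t<x = <ᵇ-asym t x t<x
makes123OverMax-larger x t (u ∷ S) t<x rewrite <ᵇ-asym t x t<x = refl

-- the maximum k, once on top of a smaller entry, shields everything below it
makes123OverMax-onMax : ∀ k t S x st → (t <ᵇ k) ≡ true → all (_<ᵇ k) st ≡ true →
  makes123OverMax x (st ++ k ∷ t ∷ S) ≡ makes123OverMax x st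
makes123OverMax-onMax k t S x []          t<k _ rewrite <ᵇ-asym t k t<k = ∧-zeroʳ (x <ᵇ k)
makes123OverMax-onMax k t S x (u ∷ [])    t<k h rewrite ∧-conicalˡ (u <ᵇ k) true h = ∧-identityʳ (x <ᵇ u)
makes123OverMax-onMax k t S x (u ∷ v ∷ _) t<k h = refl

popped-above : ∀ x st → all (x <ᵇ_) (popped makes123OverMax x st) ≡ true
popped-above x []      = refl
popped-above x (t ∷ s) with makes123OverMax x (t ∷ s) in e
... | false = refl
... | true  rewrite makes123OverMax⇒< x t s e = popped-above x s

someBelow-above : ∀ x v L → all (x <ᵇ_) L ≡ true → someBelow v L ≡ true → (x <ᵇ v) ≡ true
someBelow-above x v (u ∷ L) hL h with u <ᵇ v in e
... | true  = <ᵇ-trans x u v (∧-conicalˡ _ _ hL) e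
... | false = someBelow-above x v L (∧-conicalʳ _ _ hL) h

someBelow-push : ∀ x st v → someBelow v st ≡ true → someBelow v (x ∷ kept makes123OverMax x st) ≡ true
someBelow-push x st v h with someBelow v (popped makes123OverMax x st) in e
... | true  rewrite someBelow-above x v (popped makes123OverMax x st) (popped-above x st) e = refl
... | false = trans (cong ((x <ᵇ v) ∨_) kept-witness) (∨-zeroʳ (x <ᵇ v))
  where
  kept-witness : someBelow v (kept makes123OverMax x st) ≡ true
  kept-witness = trans (sym (cong (_∨ someBelow v (kept makes123OverMax x st)) e))
    (trans (sym (any-++ (_<ᵇ v) (popped makes123OverMax x st) _))
           (trans (cong (someBelow v) (popped++kept makes123OverMax x st)) h))

emitted-above-leftover : ∀ α st w → all (λ v → someBelow v st) w ≡ true →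
  all (λ v → someBelow v (leftover makes123OverMax α st)) (w ++ emitted makes123OverMax α st) ≡ true
emitted-above-leftover []      st w h = subst (λ z → all _ z ≡ true) (sym (++-identityʳ w)) h
emitted-above-leftover (x ∷ α) st w h =
  subst (λ z → all _ z ≡ true) (++-assoc w (popped makes123OverMax x st) _)
    (emitted-above-leftover α (x ∷ kept makes123OverMax x st) (w ++ popped makes123OverMax x st)
       (trans (all-++ _ w (popped makes123OverMax x st))
              (cong₂ _∧_ (all-mono (λ v → someBelow v st) _ (someBelow-push x st) w h)
                         (all-mono (x <ᵇ_) _ (λ v x<v → cong (_∨ someBelow v (kept makes123OverMax x st)) x<v)
                                   (popped makes123OverMax x st) (popped-above x st)))))

admissible : List ℕ → Bool
admissible α = noPops makes123OverMax [] α ∧ not (has231 (reverse α))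

stackSort-over-max : ∀ k τ → all (_<ᵇ k) τ ≡ true → stackSort makes123OverMax τ [ k ] ≡ k ∷ SCmax τ
stackSort-over-max k []      _ = refl
stackSort-over-max k (x ∷ τ) h rewrite ∧-conicalˡ (x <ᵇ k) _ h = refl

sortableAfterMax-max∷ : ∀ k τ → all (_<ᵇ k) τ ≡ true → sortableAfterMax (k ∷ τ) ≡ sortableAfterMax τ
sortableAfterMax-max∷ k τ h
  rewrite stackSort-over-max k τ h | heads231-max k (SCmax τ) (trans (all-SCmax (_<ᵇ k) τ) h) = refl

stackSort-max-onStack : ∀ k t S β → (t <ᵇ k) ≡ true → all (_<ᵇ k) β ≡ true →
  stackSort makes123OverMax (k ∷ β) (t ∷ S) ≡ SCmax β ++ k ∷ t ∷ S
stackSort-max-onStack k t S β t<k hβ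
  with no-pop makes123OverMax k (t ∷ S) (makes123OverMax-larger k t S t<k)
... | e₁ , e₂ rewrite e₁ | e₂ =
  stackSort-onFrame makes123OverMax makes123OverMax (k ∷ t ∷ S) (_<ᵇ k)
    (λ x st → makes123OverMax-onMax k t S x st t<k) (λ _ → refl) β [] hβ refl

SCmax-split : ∀ k a α β → all (_<ᵇ k) (a ∷ α) ≡ true → all (_<ᵇ k) β ≡ true →
  SCmax ((a ∷ α) ++ k ∷ β) ≡
  emitted makes123OverMax (a ∷ α) [] ++ SCmax β ++ k ∷ leftover makes123OverMax (a ∷ α) []
SCmax-split k a α β hα hβ rewrite stackSort-++ makes123OverMax (a ∷ α) (k ∷ β) []
  with leftover makes123OverMax (a ∷ α) [] | leftover-nonempty makes123OverMax α a []
     | all-emitted-leftover makes123OverMax (_<ᵇ k) (a ∷ α) []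
... | _ | t , S , refl | h = cong (emitted makes123OverMax (a ∷ α) [] ++_)
  (stackSort-max-onStack k t S β
    (∧-conicalˡ (t <ᵇ k) _ (∧-conicalʳ (all (_<ᵇ k) (emitted makes123OverMax (a ∷ α) [])) _
      (trans h (cong (_∧ true) hα)))) hβ)

sortableAfterMax-split : ∀ k a α β → all (_<ᵇ k) (a ∷ α) ≡ true → all (_<ᵇ k) β ≡ true →
  sortableAfterMax ((a ∷ α) ++ k ∷ β) ≡
  admissible (a ∷ α) ∧ (not (exceeds β (a ∷ α)) ∧ sortableAfterMax β)
sortableAfterMax-split k a α β hα hβ rewrite SCmax-split k a α β hα hβ
  with noPops makes123OverMax [] (a ∷ α) in np
... | true
  rewrite proj₁ (noPops⇒ makes123OverMax (a ∷ α) [] np) | proj₂ (noPops⇒ makes123OverMax (a ∷ α) [] np)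
        | has231-split k (SCmax β) (reverse (a ∷ α))
            (trans (all-SCmax (_<ᵇ k) β) hβ) (trans (all-↭ (_<ᵇ k) (↭-reverse (a ∷ α))) hα)
        | exceeds-↭ (SCmax↭ β) (↭-reverse (a ∷ α))
        | not-∨ (has231 (SCmax β)) (has231 (reverse (a ∷ α)) ∨ exceeds β (a ∷ α))
        | not-∨ (has231 (reverse (a ∷ α))) (exceeds β (a ∷ α)) =
  solve 3 (λ s r e → s :* (r :* e) := r :* (e :* s)) refl
    (not (has231 (SCmax β))) (not (has231 (reverse (a ∷ α)))) (not (exceeds β (a ∷ α)))
-- an entry v popped before k arrives lies above some entry left below k: v, k and that entry form a 231
... | false
  with emitted makes123OverMax (a ∷ α) [] | pops⇒ makes123OverMax (λ _ → refl) (a ∷ α) [] np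
     | all-emitted-leftover makes123OverMax (_<ᵇ k) (a ∷ α) [] | emitted-above-leftover (a ∷ α) [] [] refl
...   | _ | v , o , refl | h< | hbelow =
  cong not (subst (λ z → has231 (v ∷ z) ≡ true) (++-assoc o (SCmax β) _)
    (has231-above k v (o ++ SCmax β) (leftover makes123OverMax (a ∷ α) [])
      (∧-conicalˡ _ _ (∧-conicalˡ _ _ (trans h< (cong (_∧ true) hα)))) (∧-conicalˡ _ _ hbelow)))

noPops-max-onStack : ∀ k t S β → (t <ᵇ k) ≡ true → all (_<ᵇ k) β ≡ true →
  noPops makes123OverMax (t ∷ S) (k ∷ β) ≡ noPops makes123OverMax [] β
noPops-max-onStack k t S β t<k hβ rewrite makes123OverMax-larger k t S t<k =
  noPops-onFrame makes123OverMax makes123OverMax (k ∷ t ∷ S) (_<ᵇ k)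
    (λ x st → makes123OverMax-onMax k t S x st t<k) (λ _ → refl) β [] hβ refl

admissible-max∷ : ∀ k σ → all (_<ᵇ k) σ ≡ true → admissible (k ∷ σ) ≡ null σ
admissible-max∷ k []      _ = refl
admissible-max∷ k (y ∷ σ) h rewrite ∧-conicalˡ (y <ᵇ k) _ h = refl

reverse-split : ∀ (α β : List ℕ) k → reverse (α ++ k ∷ β) ≡ reverse β ++ k ∷ reverse α
reverse-split α β k = trans (++-ʳ++ α) (ʳ++-defn β)

admissible-split : ∀ k a α β → all (_<ᵇ k) (a ∷ α) ≡ true → all (_<ᵇ k) β ≡ true →
  admissible ((a ∷ α) ++ k ∷ β) ≡ admissible (a ∷ α) ∧ (not (exceeds β (a ∷ α)) ∧ admissible β)
admissible-split k a α β hα hβ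
  rewrite noPops-++ makes123OverMax [] (a ∷ α) (k ∷ β)
        | reverse-split (a ∷ α) β k
        | has231-split k (reverse β) (reverse (a ∷ α))
            (trans (all-↭ (_<ᵇ k) (↭-reverse β)) hβ) (trans (all-↭ (_<ᵇ k) (↭-reverse (a ∷ α))) hα)
        | exceeds-↭ (↭-reverse β) (↭-reverse (a ∷ α))
  with α ʳ++ [ a ] | ʳ++-nonempty α a [] | trans (all-↭ (_<ᵇ k) (↭-reverse (a ∷ α))) hα
... | _ | t , S , refl | h
  rewrite noPops-max-onStack k t S β (∧-conicalˡ _ _ h) hβ
        | not-∨ (has231 (reverse β)) (has231 (t ∷ S) ∨ exceeds β (a ∷ α))
        | not-∨ (has231 (t ∷ S)) (exceeds β (a ∷ α)) =
  solve 5 (λ n₁ n₂ b r e → (n₁ :* n₂) :* (b :* (r :* e)) := (n₁ :* r) :* (e :* (n₂ :* b))) refl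
    (noPops makes123OverMax [] (a ∷ α)) (noPops makes123OverMax [] β)
    (not (has231 (reverse β))) (not (has231 (t ∷ S))) (not (exceeds β (a ∷ α)))

makes123OverMax-shift : ∀ c x st → makes123OverMax (c + x) (map (c +_) st) ≡ makes123OverMax x st
makes123OverMax-shift c x []          = refl
makes123OverMax-shift c x (t ∷ [])    = <ᵇ-shift c x t
makes123OverMax-shift c x (t ∷ u ∷ _) = cong₂ _∧_ (<ᵇ-shift c x t) (<ᵇ-shift c t u)

noPops-shift : ∀ c st α → noPops makes123OverMax (map (c +_) st) (map (c +_) α) ≡ noPops makes123OverMax st α
noPops-shift c st []      = refl
noPops-shift c st (x ∷ α) = cong₂ _∧_ (cong not (makes123OverMax-shift c x st)) (noPops-shift c (x ∷ st) α)

someBelow-shift : ∀ c x w → someBelow (c + x) (map (c +_) w) ≡ someBelow x w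
someBelow-shift c x []      = refl
someBelow-shift c x (y ∷ w) = cong₂ _∨_ (<ᵇ-shift c y x) (someBelow-shift c x w)

heads231-shift : ∀ c x w → heads231 (c + x) (map (c +_) w) ≡ heads231 x w
heads231-shift c x []      = refl
heads231-shift c x (y ∷ w) =
  cong₂ _∨_ (cong₂ _∧_ (<ᵇ-shift c x y) (someBelow-shift c x w)) (heads231-shift c x w)

has231-shift : ∀ c w → has231 (map (c +_) w) ≡ has231 w
has231-shift c []      = refl
has231-shift c (x ∷ w) = cong₂ _∨_ (heads231-shift c x w) (has231-shift c w)

admissible-shift : ∀ c α → admissible (map (c +_) α) ≡ admissible α
admissible-shift c α = cong₂ _∧_ (noPops-shift c [] α)
  (cong not (trans (cong has231 (sym (reverse-map (c +_) α))) (has231-shift c (reverse α))))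

-- Finite sums

𝟙 : Bool → ℕ
𝟙 true  = 1
𝟙 false = 0

∑ : List (List ℕ) → (List ℕ → ℕ) → ℕ
∑ []      f = 0
∑ (σ ∷ L) f = f σ + ∑ L f

syntax ∑ L (λ σ → e) = ∑[ σ ∈ L ] e

∑< : ℕ → (ℕ → ℕ) → ℕ
∑< zero    f = 0
∑< (suc n) f = f 0 + ∑< n (λ i → f (suc i))

syntax ∑< n (λ i → e) = ∑[ i < n ] e

∑-++ : ∀ A B f → ∑ (A ++ B) f ≡ ∑ A f + ∑ B f
∑-++ []      B f = refl
∑-++ (σ ∷ A) B f = trans (cong (f σ +_) (∑-++ A B f)) (sym (+-assoc (f σ) _ _))

∑-concatMap : ∀ (g : List ℕ → List (List ℕ)) L f → ∑ (concatMap g L) f ≡ ∑[ σ ∈ L ] ∑ (g σ) f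
∑-concatMap g []      f = refl
∑-concatMap g (σ ∷ L) f = trans (∑-++ (g σ) _ f) (cong (∑ (g σ) f +_) (∑-concatMap g L f))

∑-map : ∀ h L f → ∑ (map h L) f ≡ ∑[ σ ∈ L ] f (h σ)
∑-map h []      f = refl
∑-map h (σ ∷ L) f = cong (f (h σ) +_) (∑-map h L f)

∑-cong : ∀ {Q : List ℕ → Set} {L} → All Q L →
         ∀ {f g} → (∀ σ → Q σ → f σ ≡ g σ) → ∑ L f ≡ ∑ L g
∑-cong []       f≡g = refl
∑-cong (q ∷ qs) f≡g = cong₂ _+_ (f≡g _ q) (∑-cong qs f≡g)

∑-+ : ∀ L f g → ∑[ σ ∈ L ] (f σ + g σ) ≡ ∑ L f + ∑ L g
∑-+ []      f g = refl
∑-+ (σ ∷ L) f g = trans (cong (f σ + g σ +_) (∑-+ L f g)) (interchange (f σ) (g σ) (∑ L f) (∑ L g))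

∑-*ˡ : ∀ c L f → ∑[ σ ∈ L ] (c * f σ) ≡ c * ∑ L f
∑-*ˡ c []      f = sym (*-zeroʳ c)
∑-*ˡ c (σ ∷ L) f = trans (cong (c * f σ +_) (∑-*ˡ c L f)) (sym (*-distribˡ-+ c (f σ) _))

∑-zero : ∀ L → ∑[ σ ∈ L ] 0 ≡ 0
∑-zero []      = refl
∑-zero (_ ∷ L) = ∑-zero L

∑-∑< : ∀ n L (h : ℕ → List ℕ → ℕ) →
       ∑[ σ ∈ L ] ∑[ i < n ] h i σ ≡ ∑[ i < n ] ∑[ σ ∈ L ] h i σ
∑-∑< zero    L h = ∑-zero L
∑-∑< (suc n) L h = trans (∑-+ L (h 0) _) (cong (∑ L (h 0) +_) (∑-∑< n L (λ i → h (suc i))))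

∑<-cong : ∀ n {f g} → (∀ i → i < n → f i ≡ g i) → ∑< n f ≡ ∑< n g
∑<-cong zero    f≡g = refl
∑<-cong (suc n) f≡g = cong₂ _+_ (f≡g 0 z<s) (∑<-cong n (λ i i<n → f≡g (suc i) (s<s i<n)))

∑<-+ : ∀ a b f → ∑< (a + b) f ≡ ∑< a f + ∑[ i < b ] f (a + i)
∑<-+ zero    b f = refl
∑<-+ (suc a) b f = trans (cong (f 0 +_) (∑<-+ a b (λ i → f (suc i)))) (sym (+-assoc (f 0) _ _))

∑<-zero : ∀ n f → (∀ i → i < n → f i ≡ 0) → ∑< n f ≡ 0
∑<-zero zero    f f≡0 = refl
∑<-zero (suc n) f f≡0 rewrite f≡0 0 z<s = ∑<-zero n (λ i → f (suc i)) (λ i i<n → f≡0 (suc i) (s<s i<n))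

∑<-* : ∀ n c d f → ∑[ j < n ] (c * f j * d) ≡ c * ∑< n f * d
∑<-* zero    c d f = cong (_* d) (sym (*-zeroʳ c))
∑<-* (suc n) c d f rewrite ∑<-* n c d (λ j → f (suc j)) =
  trans (sym (*-distribʳ-+ d (c * f 0) _)) (cong (_* d) (sym (*-distribˡ-+ c (f 0) _)))

∑<-last : ∀ n f → ∑< (suc n) f ≡ ∑< n f + f n
∑<-last zero    f = +-comm (f 0) 0
∑<-last (suc n) f = trans (cong (f 0 +_) (∑<-last n (λ i → f (suc i)))) (sym (+-assoc (f 0) _ _))

𝟙-*-cong : ∀ b {x y} z → (b ≡ true → x ≡ y) → 𝟙 b * x * z ≡ 𝟙 b * y * z
𝟙-*-cong true  z x≡y rewrite x≡y refl = refl
𝟙-*-cong false z x≡y = refl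

𝟙-∧ : ∀ a b c → 𝟙 (a ∧ (b ∧ c)) ≡ 𝟙 b * 𝟙 a * 𝟙 c
𝟙-∧ true  true  c = sym (+-identityʳ (𝟙 c))
𝟙-∧ true  false c = refl
𝟙-∧ false true  c = refl
𝟙-∧ false false c = refl

length-filter : ∀ (f : List ℕ → Bool) L → length (filter (λ π → T? (f π)) L) ≡ ∑[ π ∈ L ] 𝟙 (f π)
length-filter f []      = refl
length-filter f (π ∷ L) with f π
... | true  = cong suc (length-filter f L)
... | false = length-filter f L

-- Inserting a new maximum

insertAt : ℕ → ℕ → List ℕ → List ℕ
insertAt j k σ = take j σ ++ k ∷ drop j σ

∑-insertAll : ∀ f k σ → ∑ (insertAll k σ) f ≡ ∑[ j < suc (length σ) ] f (insertAt j k σ)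
∑-insertAll f k []      = refl
∑-insertAll f k (y ∷ σ) = cong (f (k ∷ y ∷ σ) +_)
  (trans (∑-map (y ∷_) (insertAll k σ) f) (∑-insertAll (λ τ → f (y ∷ τ)) k σ))

insertAt↭ : ∀ j k u → insertAt j k u ↭ k ∷ u
insertAt↭ j k u = ↭-trans (shift k (take j u) (drop j u)) (↭-prep k (↭-reflexive (take++drop≡id j u)))

insertAll↭ : ∀ k σ → All (_↭ k ∷ σ) (insertAll k σ)
insertAll↭ k []      = ↭-refl ∷ []
insertAll↭ k (y ∷ σ) =
  ↭-refl ∷ All-map⁺ (All.map (λ τ↭ → ↭-trans (↭-prep y τ↭) (↭-swap y k ↭-refl)) (insertAll↭ k σ))

maximum : List ℕ → ℕ
maximum = foldr _⊔_ 0

maximum-↭ : ∀ {xs ys} → xs ↭ ys → maximum xs ≡ maximum ys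
maximum-↭ xs↭ys = foldr-commMonoid (setoid ℕ) ⊔-0-isCommutativeMonoid (↭⇒↭ₛ xs↭ys)

maximum-++ : ∀ u v → maximum (u ++ v) ≡ maximum u ⊔ maximum v
maximum-++ []      v = refl
maximum-++ (x ∷ u) v = trans (cong (x ⊔_) (maximum-++ u v)) (sym (⊔-assoc x _ _))

maximum-shift : ∀ c y ys → maximum (map (c +_) (y ∷ ys)) ≡ c + maximum (y ∷ ys)
maximum-shift c y []       = trans (⊔-identityʳ (c + y)) (cong (c +_) (sym (⊔-identityʳ y)))
maximum-shift c y (z ∷ zs) = trans (cong ((c + y) ⊔_) (maximum-shift c z zs)) (sym (+-distribˡ-⊔ c y _))

record Shape (m : ℕ) (σ : List ℕ) : Set where
  field
    length≡  : length σ ≡ m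
    bounded  : all (_<ᵇ suc m) σ ≡ true
    maximum≡ : maximum σ ≡ m

Shape-S : ∀ m → All (Shape m) (S m)
Shape-S zero    = record { length≡ = refl ; bounded = refl ; maximum≡ = refl } ∷ []
Shape-S (suc m) = concat⁺ (All-map⁺ (All.map shape-insertAll (Shape-S m)))
  where
  shape-insertAll : ∀ {σ} → Shape m σ → All (Shape (suc m)) (insertAll (suc m) σ)
  shape-insertAll {σ} sh = All.map shape (insertAll↭ (suc m) σ)
    where
    shape : ∀ {τ} → τ ↭ suc m ∷ σ → Shape (suc m) τ
    shape τ↭ = record
      { length≡  = trans (↭-length τ↭) (cong suc (Shape.length≡ sh))
      ; bounded  = trans (all-↭ _ τ↭) (cong₂ _∧_ (<ᵇ-true (n<1+n (suc m)))
                     (all-mono _ _ (λ v v<m → <ᵇ-trans v (suc m) (suc (suc m)) v<m (<ᵇ-true (n<1+n (suc m))))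
                               σ (Shape.bounded sh)))
      ; maximum≡ = trans (maximum-↭ τ↭)
                     (trans (cong (suc m ⊔_) (Shape.maximum≡ sh)) (m≥n⇒m⊔n≡m (n≤1+n m)))
      }

take-drop-insertAt-≤ : ∀ j p k σ → j ≤ p →
  take (suc p) (insertAt j k σ) ≡ insertAt j k (take p σ) × drop (suc p) (insertAt j k σ) ≡ drop p σ
take-drop-insertAt-≤ zero    p       k σ       _         = refl , refl
take-drop-insertAt-≤ (suc j) (suc p) k []      _         = refl , refl
take-drop-insertAt-≤ (suc j) (suc p) k (y ∷ σ) (s≤s j≤p) with take-drop-insertAt-≤ j p k σ j≤p
... | e₁ , e₂ = cong (y ∷_) e₁ , e₂

take-drop-insertAt-+ : ∀ a i k σ → a ≤ length σ →
  take a (insertAt (a + i) k σ) ≡ take a σ × drop a (insertAt (a + i) k σ) ≡ insertAt i k (drop a σ)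
take-drop-insertAt-+ zero    i k σ       _         = refl , refl
take-drop-insertAt-+ (suc a) i k (y ∷ σ) (s≤s a≤n) with take-drop-insertAt-+ a i k σ a≤n
... | e₁ , e₂ = cong (y ∷_) e₁ , e₂

insertAt-map : ∀ (f : ℕ → ℕ) j k γ → insertAt j (f k) (map f γ) ≡ map f (insertAt j k γ)
insertAt-map f j k γ rewrite take-map {f = f} j γ | drop-map {f = f} j γ = sym (map-++ f (take j γ) (k ∷ drop j γ))

exceeds-insertMax : ∀ j k u v → all (_<ᵇ k) v ≡ true → exceeds v (insertAt j k u) ≡ exceeds v u
exceeds-insertMax j k u []      _ = refl
exceeds-insertMax j k u (z ∷ v) h =
  cong₂ _∨_ (trans (any-↭ (_<ᵇ z) (insertAt↭ j k u))
                   (cong (_∨ someBelow z u) (<ᵇ-asym z k (∧-conicalˡ _ _ h))))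
            (exceeds-insertMax j k u v (∧-conicalʳ _ _ h))

exceeds-insertMax-below : ∀ i k d y u → (y <ᵇ k) ≡ true → exceeds (insertAt i k d) (y ∷ u) ≡ true
exceeds-insertMax-below i k d y u y<k rewrite exceeds-↭ (insertAt↭ i k d) (↭-refl {x = y ∷ u}) | y<k = refl

maximum-below : ∀ v y u → exceeds v (y ∷ u) ≡ false → maximum v ≤ y
maximum-below []      y u _ = z≤n
maximum-below (z ∷ v) y u h =
  ⊔-lub (<ᵇ-false⇒≥ y z (∨-conicalˡ _ _ (∨-conicalˡ _ _ h))) (maximum-below v y u (∨-conicalʳ _ _ h))

-- Permutations beginning with their largest entries

ShiftInvariant : (List ℕ → ℕ) → Set
ShiftInvariant F = ∀ c α → F (map (c +_) α) ≡ F α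

insertMax : (List ℕ → ℕ) → List ℕ → ℕ
insertMax F γ = ∑[ j < suc (length γ) ] F (insertAt j (suc (maximum γ)) γ)

insertMax-shiftInvariant : ∀ F → ShiftInvariant F → ShiftInvariant (insertMax F)
insertMax-shiftInvariant F inv c []       = refl
insertMax-shiftInvariant F inv c (y ∷ ys) rewrite length-map (c +_) ys =
  ∑<-cong (suc (suc (length ys))) λ j _ → begin
    F (insertAt j (suc (maximum (map (c +_) (y ∷ ys)))) (map (c +_) (y ∷ ys)))
      ≡⟨ cong (λ M → F (insertAt j M (map (c +_) (y ∷ ys))))
              (trans (cong suc (maximum-shift c y ys)) (sym (+-suc c (maximum (y ∷ ys))))) ⟩
    F (insertAt j (c + suc (maximum (y ∷ ys))) (map (c +_) (y ∷ ys)))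
      ≡⟨ cong F (insertAt-map (c +_) j (suc (maximum (y ∷ ys))) (y ∷ ys)) ⟩
    F (map (c +_) (insertAt j (suc (maximum (y ∷ ys))) (y ∷ ys)))
      ≡⟨ inv c _ ⟩
    F (insertAt j (suc (maximum (y ∷ ys))) (y ∷ ys)) ∎
  where open ≡-Reasoning

∑-S-insertMax : ∀ p F → ∑ (S (suc p)) F ≡ ∑[ γ ∈ S p ] insertMax F γ
∑-S-insertMax p F = trans (∑-concatMap (insertAll (suc p)) (S p) F)
  (∑-cong (Shape-S p) λ γ sh → trans (∑-insertAll F (suc p) γ)
    (cong (λ M → ∑[ j < suc (length γ) ] F (insertAt j (suc M) γ)) (sym (Shape.maximum≡ sh))))

-- the first p entries of τ are its p largest ones
topBlock : ℕ → List ℕ → Bool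
topBlock p τ = not (exceeds (drop p τ) (take p τ))

splitWeight : (List ℕ → ℕ) → (List ℕ → ℕ) → ℕ → List ℕ → ℕ
splitWeight F G p τ = 𝟙 (topBlock p τ) * F (take p τ) * G (drop p τ)

splitWeight-at : ∀ F G p τ {u v} → take p τ ≡ u → drop p τ ≡ v →
  splitWeight F G p τ ≡ 𝟙 (not (exceeds v u)) * F u * G v
splitWeight-at F G p τ refl refl = refl

splitWeight-newMax-inPrefix : ∀ m p F G σ → Shape m σ → ∀ j → j ≤ p →
  splitWeight F G (suc p) (insertAt j (suc m) σ) ≡
  𝟙 (topBlock p σ) * F (insertAt j (suc m) (take p σ)) * G (drop p σ)
splitWeight-newMax-inPrefix m p F G σ sh j j≤p =
  trans (splitWeight-at F G (suc p) _ (proj₁ td) (proj₂ td))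
        (cong (λ b → 𝟙 (not b) * F (insertAt j (suc m) (take p σ)) * G (drop p σ))
              (exceeds-insertMax j (suc m) (take p σ) (drop p σ)
                 (∧-conicalʳ _ _ (trans (sym (all-take-drop (_<ᵇ suc m) p σ)) (Shape.bounded sh)))))
  where td = take-drop-insertAt-≤ j p (suc m) σ j≤p

splitWeight-newMax-inSuffix : ∀ m p F G σ → Shape m σ → ∀ i → i < m ∸ p →
  splitWeight F G (suc p) (insertAt (suc p + i) (suc m) σ) ≡ 0
splitWeight-newMax-inSuffix m p F G σ sh i i<m∸p
  with σ | Shape.length≡ sh | Shape.bounded sh | m∸n≢0⇒n<m {m} {p} (λ e → n≮0 (subst (i <_) e i<m∸p))
... | y ∷ σ | refl | h | p<m =
  trans (splitWeight-at F G (suc p) _ (proj₁ td) (proj₂ td))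
        (cong (λ b → 𝟙 (not b) * F (y ∷ take p σ) * G (insertAt i (suc m) (drop p σ)))
              (exceeds-insertMax-below i (suc m) (drop p σ) y (take p σ) (∧-conicalˡ _ _ h)))
  where td = take-drop-insertAt-+ (suc p) i (suc m) (y ∷ σ) p<m

∑-insertAt-topBlock : ∀ m p F → ShiftInvariant F → p ≤ m → ∀ σ → Shape m σ → topBlock p σ ≡ true →
  ∑[ j < suc p ] F (insertAt j (suc m) (take p σ)) ≡ insertMax F (take p σ)
∑-insertAt-topBlock m zero    F inv _   σ _  _ = cong (_+ 0) (trans (cong (λ z → F [ z ]) (+-comm 1 m)) (inv m [ 1 ]))
∑-insertAt-topBlock m (suc p) F inv p≤m σ sh top with σ | Shape.length≡ sh | Shape.maximum≡ sh
... | y ∷ σ | refl | max≡ =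
  sym (cong₂ (λ n M → ∑[ j < suc n ] F (insertAt j (suc M) u)) length≡ (trans maximum≡ max≡))
  where
  u v : List ℕ
  u = take (suc p) (y ∷ σ)
  v = drop (suc p) (y ∷ σ)
  length≡ : length u ≡ suc p
  length≡ = trans (length-take (suc p) (y ∷ σ)) (m≤n⇒m⊓n≡m p≤m)
  maximum≡ : maximum u ≡ maximum (y ∷ σ)
  maximum≡ = sym (begin
    maximum (y ∷ σ)         ≡⟨ cong maximum (sym (take++drop≡id (suc p) (y ∷ σ))) ⟩
    maximum (u ++ v)        ≡⟨ maximum-++ u v ⟩
    maximum u ⊔ maximum v   ≡⟨ m≥n⇒m⊔n≡m (≤-trans (maximum-below v y (take p σ) (not-injective top)) (m≤m⊔n y _)) ⟩
    maximum u               ∎)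
    where open ≡-Reasoning

∑-splitWeight-insertAll : ∀ m p F G → ShiftInvariant F → p ≤ m → ∀ σ → Shape m σ →
  ∑ (insertAll (suc m) σ) (splitWeight F G (suc p)) ≡ splitWeight (insertMax F) G p σ
∑-splitWeight-insertAll m p F G inv p≤m σ sh = begin
  ∑ (insertAll (suc m) σ) (splitWeight F G (suc p))
    ≡⟨ ∑-insertAll (splitWeight F G (suc p)) (suc m) σ ⟩
  ∑< (suc (length σ)) w
    ≡⟨ cong (λ n → ∑< (suc n) w) (trans (Shape.length≡ sh) (sym (m+[n∸m]≡n p≤m))) ⟩
  ∑< (suc p + (m ∸ p)) w
    ≡⟨ ∑<-+ (suc p) (m ∸ p) w ⟩
  ∑< (suc p) w + ∑[ i < m ∸ p ] w (suc p + i)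
    ≡⟨ cong₂ _+_ (∑<-cong (suc p) λ j j<1+p → splitWeight-newMax-inPrefix m p F G σ sh j (≤-pred j<1+p))
                 (∑<-zero (m ∸ p) _ (splitWeight-newMax-inSuffix m p F G σ sh)) ⟩
  ∑[ j < suc p ] (𝟙 (topBlock p σ) * F (insertAt j (suc m) (take p σ)) * G (drop p σ)) + 0
    ≡⟨ +-identityʳ _ ⟩
  ∑[ j < suc p ] (𝟙 (topBlock p σ) * F (insertAt j (suc m) (take p σ)) * G (drop p σ))
    ≡⟨ ∑<-* (suc p) (𝟙 (topBlock p σ)) (G (drop p σ)) (λ j → F (insertAt j (suc m) (take p σ))) ⟩
  𝟙 (topBlock p σ) * ∑[ j < suc p ] F (insertAt j (suc m) (take p σ)) * G (drop p σ)
    ≡⟨ 𝟙-*-cong (topBlock p σ) (G (drop p σ)) (∑-insertAt-topBlock m p F inv p≤m σ sh) ⟩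
  splitWeight (insertMax F) G p σ ∎
  where
  open ≡-Reasoning
  w : ℕ → ℕ
  w j = splitWeight F G (suc p) (insertAt j (suc m) σ)

-- the permutations of [m] whose first p entries are its p largest ones are the shifted
-- permutations of [p] followed by the permutations of [m - p]
∑-splitWeight : ∀ m p → p ≤ m → ∀ F G → ShiftInvariant F →
  ∑ (S m) (splitWeight F G p) ≡ ∑ (S p) F * ∑ (S (m ∸ p)) G
∑-splitWeight m zero _ F G _ = begin
  ∑ (S m) (splitWeight F G 0)
    ≡⟨ ∑-cong (Shape-S m) (λ τ _ → cong (λ b → 𝟙 (not b) * F [] * G τ) (exceeds-[] τ)) ⟩
  ∑[ τ ∈ S m ] (1 * F [] * G τ)     ≡⟨ ∑-*ˡ (1 * F []) (S m) G ⟩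
  1 * F [] * ∑ (S m) G             ≡⟨ cong (_* ∑ (S m) G) (*-identityˡ (F [])) ⟩
  F [] * ∑ (S m) G                 ≡⟨ cong (_* ∑ (S m) G) (sym (+-identityʳ (F []))) ⟩
  (F [] + 0) * ∑ (S m) G           ∎
  where open ≡-Reasoning
∑-splitWeight (suc m) (suc p) (s≤s p≤m) F G inv = begin
  ∑ (concatMap (insertAll (suc m)) (S m)) (splitWeight F G (suc p))
    ≡⟨ ∑-concatMap (insertAll (suc m)) (S m) _ ⟩
  ∑[ σ ∈ S m ] ∑ (insertAll (suc m) σ) (splitWeight F G (suc p))
    ≡⟨ ∑-cong (Shape-S m) (∑-splitWeight-insertAll m p F G inv p≤m) ⟩
  ∑ (S m) (splitWeight (insertMax F) G p)
    ≡⟨ ∑-splitWeight m p p≤m (insertMax F) G (insertMax-shiftInvariant F inv) ⟩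
  ∑ (S p) (insertMax F) * ∑ (S (m ∸ p)) G
    ≡⟨ cong (_* ∑ (S (m ∸ p)) G) (sym (∑-S-insertMax p F)) ⟩
  ∑ (S (suc p)) F * ∑ (S (m ∸ p)) G ∎
  where open ≡-Reasoning

-- The recurrences

count : (List ℕ → Bool) → ℕ → ℕ
count P m = ∑[ σ ∈ S m ] 𝟙 (P σ)

SplitsAtMax : (List ℕ → Bool) → Set
SplitsAtMax P = ∀ k a α β → all (_<ᵇ k) (a ∷ α) ≡ true → all (_<ᵇ k) β ≡ true →
  P ((a ∷ α) ++ k ∷ β) ≡ admissible (a ∷ α) ∧ (not (exceeds β (a ∷ α)) ∧ P β)

count-suc : ∀ P → SplitsAtMax P → ∀ m →
  count P (suc m) ≡
  (∑[ σ ∈ S m ] 𝟙 (P (suc m ∷ σ))) + ∑[ i < m ] (count admissible (suc i) * count P (m ∸ suc i))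
count-suc P split m = begin
  ∑ (concatMap (insertAll (suc m)) (S m)) (𝟙 ∘ P)
    ≡⟨ ∑-concatMap (insertAll (suc m)) (S m) (𝟙 ∘ P) ⟩
  ∑[ σ ∈ S m ] ∑ (insertAll (suc m) σ) (𝟙 ∘ P)
    ≡⟨ ∑-cong (Shape-S m) insertMax-split ⟩
  ∑[ σ ∈ S m ] (𝟙 (P (suc m ∷ σ)) + ∑[ i < m ] splitWeight (𝟙 ∘ admissible) (𝟙 ∘ P) (suc i) σ)
    ≡⟨ ∑-+ (S m) _ _ ⟩
  (∑[ σ ∈ S m ] 𝟙 (P (suc m ∷ σ))) + ∑[ σ ∈ S m ] ∑[ i < m ] splitWeight (𝟙 ∘ admissible) (𝟙 ∘ P) (suc i) σ
    ≡⟨ cong ((∑[ σ ∈ S m ] 𝟙 (P (suc m ∷ σ))) +_) (trans (∑-∑< m (S m) _)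
         (∑<-cong m λ i i<m → ∑-splitWeight m (suc i) i<m (𝟙 ∘ admissible) (𝟙 ∘ P)
                                (λ c α → cong 𝟙 (admissible-shift c α)))) ⟩
  (∑[ σ ∈ S m ] 𝟙 (P (suc m ∷ σ))) + ∑[ i < m ] (count admissible (suc i) * count P (m ∸ suc i)) ∎
  where
  open ≡-Reasoning
  insertMax-split : ∀ σ → Shape m σ →
    ∑ (insertAll (suc m) σ) (𝟙 ∘ P) ≡
    𝟙 (P (suc m ∷ σ)) + ∑[ i < m ] splitWeight (𝟙 ∘ admissible) (𝟙 ∘ P) (suc i) σ
  insertMax-split σ sh = trans (∑-insertAll (𝟙 ∘ P) (suc m) σ)
    (cong (𝟙 (P (suc m ∷ σ)) +_)
      (trans (cong (λ n → ∑[ j < n ] 𝟙 (P (insertAt (suc j) (suc m) σ))) (Shape.length≡ sh))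
             (∑<-cong m λ i i<m → insertedAfter i i<m σ (Shape.length≡ sh) (Shape.bounded sh))))
    where
    insertedAfter : ∀ i → i < m → ∀ σ → length σ ≡ m → all (_<ᵇ suc m) σ ≡ true →
      𝟙 (P (insertAt (suc i) (suc m) σ)) ≡ splitWeight (𝟙 ∘ admissible) (𝟙 ∘ P) (suc i) σ
    insertedAfter i () [] refl _
    insertedAfter i i<m (y ∷ σ) _ h =
      trans (cong 𝟙 (split (suc m) y (take i σ) (drop i σ) (∧-conicalˡ _ _ h′) (∧-conicalʳ _ _ h′)))
            (𝟙-∧ (admissible (y ∷ take i σ)) (not (exceeds (drop i σ) (y ∷ take i σ))) (P (drop i σ)))
      where h′ = trans (sym (all-take-drop (_<ᵇ suc m) (suc i) (y ∷ σ))) h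

count-sortableAfterMax-suc : ∀ m → count sortableAfterMax (suc m) ≡
  count sortableAfterMax m + ∑[ i < m ] (count admissible (suc i) * count sortableAfterMax (m ∸ suc i))
count-sortableAfterMax-suc m = trans (count-suc sortableAfterMax sortableAfterMax-split m)
  (cong₂ _+_ (∑-cong (Shape-S m) λ σ sh → cong 𝟙 (sortableAfterMax-max∷ (suc m) σ (Shape.bounded sh))) refl)

count-admissible-suc : ∀ m → count admissible (suc m) ≡
  𝟙 (m ≡ᵇ 0) + ∑[ i < m ] (count admissible (suc i) * count admissible (m ∸ suc i))
count-admissible-suc m = trans (count-suc admissible admissible-split m)
  (cong₂ _+_ (trans (∑-cong (Shape-S m) λ σ sh → cong 𝟙 (admissible-max∷ (suc m) σ (Shape.bounded sh)))
                    (nulls m))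
             refl)
  where
  nulls : ∀ m → ∑[ σ ∈ S m ] 𝟙 (null σ) ≡ 𝟙 (m ≡ᵇ 0)
  nulls zero    = refl
  nulls (suc m) = trans (∑-cong (Shape-S (suc m)) nonempty) (∑-zero (S (suc m)))
    where
    nonempty : ∀ σ → Shape (suc m) σ → 𝟙 (null σ) ≡ 0
    nonempty (_ ∷ _) _ = refl

Motzkin-suc : ∀ n → Motzkin (suc n) ≡ Motzkin n + ∑[ i < n ] (Motzkin i * Motzkin (n ∸ suc i))
Motzkin-suc n = cong (Motzkin n +_) (begin
  sum (zipWith _*_ (motzRev n) (reverse (motzRev n)))
    ≡⟨ cong (λ l → sum (zipWith _*_ l (reverse l))) (motzRev≡ n) ⟩
  sum (zipWith _*_ (applyDownFrom Motzkin n) (reverse (applyDownFrom Motzkin n)))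
    ≡⟨ cong (λ l → sum (zipWith _*_ (applyDownFrom Motzkin n) l)) (reverse-applyDownFrom Motzkin n) ⟩
  sum (zipWith _*_ (applyDownFrom Motzkin n) (applyUpTo Motzkin n))
    ≡⟨ sum-zipWith Motzkin Motzkin n ⟩
  ∑[ i < n ] (Motzkin (n ∸ suc i) * Motzkin i)
    ≡⟨ ∑<-cong n (λ i _ → *-comm (Motzkin (n ∸ suc i)) (Motzkin i)) ⟩
  ∑[ i < n ] (Motzkin i * Motzkin (n ∸ suc i)) ∎)
  where
  open ≡-Reasoning
  motzRev≡ : ∀ n → motzRev n ≡ applyDownFrom Motzkin n
  motzRev≡ zero    = refl
  motzRev≡ (suc n) = cong (Motzkin n ∷_) (motzRev≡ n)
  sum-zipWith : ∀ (f g : ℕ → ℕ) n →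
    sum (zipWith _*_ (applyDownFrom f n) (applyUpTo g n)) ≡ ∑[ i < n ] (f (n ∸ suc i) * g i)
  sum-zipWith f g zero    = refl
  sum-zipWith f g (suc n) = cong (f n * g 0 +_) (sum-zipWith f (λ i → g (suc i)) n)

m∸n≡suc[m∸suc[n]] : ∀ m n → n < m → m ∸ n ≡ suc (m ∸ suc n)
m∸n≡suc[m∸suc[n]] (suc m) zero    _         = refl
m∸n≡suc[m∸suc[n]] (suc m) (suc n) (s≤s n<m) = m∸n≡suc[m∸suc[n]] m n n<m

MotzkinCounts : ℕ → Set
MotzkinCounts m = count admissible (suc m) ≡ Motzkin m × count sortableAfterMax m ≡ Motzkin m

counts≡Motzkin : ∀ m → MotzkinCounts m
counts≡Motzkin = <-rec MotzkinCounts step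
  where
  step : ∀ m → (∀ {j} → j < m → MotzkinCounts j) → MotzkinCounts m
  step zero    _  = refl , refl
  step (suc m) IH = admissible≡ , sortable≡
    where
    open ≡-Reasoning
    a≡ : ∀ i → i < m →
      count admissible (suc i) * count admissible (m ∸ i) ≡ Motzkin i * Motzkin (m ∸ suc i)
    a≡ i i<m = cong₂ _*_ (proj₁ (IH (m<n⇒m<1+n i<m)))
      (trans (cong (count admissible) (m∸n≡suc[m∸suc[n]] m i i<m)) (proj₁ (IH (s≤s (m∸n≤m m (suc i))))))
    g≡ : ∀ i → i < m →
      count admissible (suc i) * count sortableAfterMax (m ∸ suc i) ≡ Motzkin i * Motzkin (m ∸ suc i)
    g≡ i i<m = cong₂ _*_ (proj₁ (IH (m<n⇒m<1+n i<m))) (proj₂ (IH (s≤s (m∸n≤m m (suc i)))))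
    admissible≡ : count admissible (suc (suc m)) ≡ Motzkin (suc m)
    admissible≡ = begin
      count admissible (suc (suc m))
        ≡⟨ count-admissible-suc (suc m) ⟩
      ∑[ i < suc m ] (count admissible (suc i) * count admissible (m ∸ i))
        ≡⟨ ∑<-last m _ ⟩
      ∑[ i < m ] (count admissible (suc i) * count admissible (m ∸ i))
        + count admissible (suc m) * count admissible (m ∸ m)
        ≡⟨ cong₂ _+_ (∑<-cong m a≡) (cong₂ _*_ (proj₁ (IH ≤-refl)) (cong (count admissible) (n∸n≡0 m))) ⟩
      ∑[ i < m ] (Motzkin i * Motzkin (m ∸ suc i)) + Motzkin m * 1
        ≡⟨ trans (cong₂ _+_ refl (*-identityʳ (Motzkin m))) (+-comm _ (Motzkin m)) ⟩
      Motzkin m + ∑[ i < m ] (Motzkin i * Motzkin (m ∸ suc i))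
        ≡⟨ Motzkin-suc m ⟨
      Motzkin (suc m) ∎
    sortable≡ : count sortableAfterMax (suc m) ≡ Motzkin (suc m)
    sortable≡ = begin
      count sortableAfterMax (suc m)
        ≡⟨ count-sortableAfterMax-suc m ⟩
      count sortableAfterMax m + ∑[ i < m ] (count admissible (suc i) * count sortableAfterMax (m ∸ suc i))
        ≡⟨ cong₂ _+_ (proj₂ (IH ≤-refl)) (∑<-cong m g≡) ⟩
      Motzkin m + ∑[ i < m ] (Motzkin i * Motzkin (m ∸ suc i))
        ≡⟨ Motzkin-suc m ⟨
      Motzkin (suc m) ∎

countSortFirstN≡count : ∀ n → countSortFirstN (suc n) ≡ count sortableAfterMax n
countSortFirstN≡count n = trans (length-filter firstMaxSortable (S (suc n)))
  (trans (∑-concatMap (insertAll (suc n)) (S n) (𝟙 ∘ firstMaxSortable))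
         (∑-cong (Shape-S n) λ σ sh → only-front (suc n) σ (Shape.bounded sh)))
  where
  firstMaxSortable : List ℕ → Bool
  firstMaxSortable π = firstIs (suc n) π ∧ sortable π
  not-first : ∀ y k L → (y <ᵇ k) ≡ true → ∑[ π ∈ map (y ∷_) L ] 𝟙 (firstIs k π ∧ sortable π) ≡ 0
  not-first y k []      _   = refl
  not-first y k (τ ∷ L) y<k rewrite <ᵇ⇒≢ᵇ y k y<k = not-first y k L y<k
  only-front : ∀ k σ → all (_<ᵇ k) σ ≡ true →
    ∑[ π ∈ insertAll k σ ] 𝟙 (firstIs k π ∧ sortable π) ≡ 𝟙 (sortableAfterMax σ)
  only-front k []      h rewrite ≡ᵇ-refl k = refl
  only-front k (y ∷ σ) h rewrite ≡ᵇ-refl k | not-first y k (insertAll k σ) (∧-conicalˡ (y <ᵇ k) _ h) =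
    trans (+-identityʳ _) (cong 𝟙 (sortable-max∷ k (y ∷ σ) h))

lemma6p7 : ∀ (n : ℕ) → n ≥ 1 → countSortFirstN n ≡ Motzkin (n ∸ 1)
lemma6p7 (suc n) _ = trans (countSortFirstN≡count n) (proj₂ (counts≡Motzkin n))
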